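{- Let $(X,d)$ be a premetric space and let $(\widehat{X},\widehat{d})$ be the premetric space of equivalence classes of Cauchy families on $X$. The function $i:X\to\widehat{X}$ defined by $i(x)=x^*$, the equivalence class of the Cauchy family $\{\{x\}\}$, is an isometric embedding with dense image.
   Context: A premetric on a nonempty set $X$ is a relation $d$ between $X\times X$ and the nonnegative rationals, written $d(x,y)\leq q$, such that for all $x,y,z\in X$ and nonnegative rationals $p,q$: (1) $d(x,y)\leq 0$ iff $x=y$; (2) $d(x,y)\leq q$ implies $d(y,x)\leq q$; (3) $d(x,z)\leq p$ and $d(z,y)\leq q$ imply $d(x,y)\leq p+q$; (4) $d(x,y)\leq p$ iff $d(x,y)\leq q$ for all rationals $q>p$. For $A\subseteq X$, $\operatorname{diam} A\leq q$ means $d(x,y)\leq q$ for all $x,y\in A$. A Cauchy family on $X$ is $F\subseteq\mathcal{P}(X)$ with (i) $S\cap T\neq\emptyset$ for all $S,T\in F$ and (ii) for every rational $\varepsilon>0$ some $S\in F$ has $\operatorname{diam} S\leq\varepsilon$. For Cauchy families $F,F'$ and a nonnegative rational $q$, $d(F,F')\leq q$ means: for every rational $\varepsilon>0$ there exist $S\in F$, $T\in F'$ with $\operatorname{diam} S,\operatorname{diam} T\leq\varepsilon$ and $\operatorname{diam}(S\cup T)\leq q+\varepsilon$. This is a pseudo-premetric; $F\sim F'$ iff $d(F,F')\leq 0$ is an equivalence relation, $\widehat{X}$ is the set of equivalence classes $[F]$, and $\widehat{d}([F],[F'])\leq q$ iff $d(F,F')\leq q$. A map $f:(X,d_X)\to(Y,d_Y)$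 between premetric spaces is an isometric embedding if $d_X(x,x')\leq q \iff d_Y(f(x),f(x'))\leq q$ for all $x,x'\in X$ and nonnegative rationals $q$. A subset $D\subseteq Y$ is dense if for every rational $\varepsilon>0$ and $y\in Y$ there is $z\in D$ with $d_Y(z,y)\leq\varepsilon$. -}

module Defs where

open import Data.Rational using (ℚ; 0ℚ; _≤_; _<_; _+_)
open import Data.Product using (Σ; ∃; _×_; _,_)
open import Data.Sum using (_⊎_)
open import Relation.Binary.PropositionalEquality using (_≡_)
open import Function.Bundles using (_⇔_)

-- A premetric: a relation  d x y q  read "d(x,y) ≤ q", meaningful for
-- nonnegative rationals q (the axioms quantify only over q ≥ 0).
record IsPremetric {X : Set} (d : X → X → ℚ → Set) : Set where
  field
    zero-iff : ∀ x y → (d x y 0ℚ ⇔ x ≡ y)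
    sym      : ∀ x y q → 0ℚ ≤ q → d x y q → d y x q
    triangle : ∀ x y z p q → 0ℚ ≤ p → 0ℚ ≤ q →
               d x z p → d z y q → d x y (p + q)
    limit    : ∀ x y p → 0ℚ ≤ p →
               (d x y p ⇔ (∀ q → p < q → d x y q))

Subset : Set → Set₁
Subset X = X → Set

Family : Set → Set₁
Family X = Subset X → Set

module _ {X : Set} (d : X → X → ℚ → Set) where

  Diam≤ : Subset X → ℚ → Set
  Diam≤ A q = ∀ x y → A x → A y → d x y q

  _∪_ : Subset X → Subset X → Subset X
  (S ∪ T) x = S x ⊎ T x

  record IsCauchy (F : Family X) : Set₁ where
    field
      intersect : ∀ S T → F S → F T → ∃ λ x → S x × T x
      small     : ∀ ε → 0ℚ < ε → Σ (Subset X) λ S → F S × Diam≤ S ε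

  FamDist≤ : Family X → Family X → ℚ → Set₁
  FamDist≤ F F' q =
    ∀ ε → 0ℚ < ε →
      Σ (Subset X) λ S → Σ (Subset X) λ T →
        F S × F' T × Diam≤ S ε × Diam≤ T ε × Diam≤ (S ∪ T) (q + ε)

singleton : {X : Set} → X → Subset X
singleton x y = y ≡ x

singletonFamily : {X : Set} → X → Family X
singletonFamily x S = ∀ y → (S y ⇔ singleton x y)

-- Everything reduces to two facts about a premetric: bounds may be enlarged
-- (from the limit axiom) and d(x,x) ≤ q for every q ≥ 0. The singleton {x}
-- then has every diameter, so {{x}} is Cauchy; any union {x} ∪ {x'} witnesses
-- d(x*,x'*) ≤ q from d(x,x') ≤ q, and conversely such unions give
-- d(x,x') ≤ q + ε for all ε > 0, hence d(x,x') ≤ q by the limit axiom. For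
-- density, take x in a member S of F with diam S ≤ ε: every member T of F with
-- diam T ≤ δ meets S, so {x} ∪ T has diameter at most ε + δ.
module Submission where

open import Defs
open import Data.Rational using (ℚ; 0ℚ; _≤_; _<_; _+_; -_)
open import Data.Rational.Properties
  using (≤-refl; ≤-trans; <⇒≤; ≤-<-trans; +-mono-≤; +-monoˡ-≤; +-monoʳ-<;
         +-identityˡ; +-identityʳ; +-inverseˡ; +-0-group)
open import Algebra.Properties.Group +-0-group using (\\-leftDividesˡ)
open import Data.Product using (∃; _×_; _,_)
open import Data.Sum using (inj₁; inj₂)
open import Function.Bundles using (_⇔_; mk⇔; Equivalence)
open import Relation.Binary.PropositionalEquality using (_≡_; refl; subst)

0≤p+q : ∀ {p q} → 0ℚ ≤ p → 0ℚ ≤ q → 0ℚ ≤ p + q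
0≤p+q {p} {q} 0≤p 0≤q = subst (_≤ p + q) (+-identityʳ 0ℚ) (+-mono-≤ 0≤p 0≤q)

q≤p+q : ∀ {p} q → 0ℚ ≤ p → q ≤ p + q
q≤p+q {p} q 0≤p = subst (_≤ p + q) (+-identityˡ q) (+-monoˡ-≤ q 0≤p)

p<p+q : ∀ p {q} → 0ℚ < q → p < p + q
p<p+q p {q} 0<q = subst (_< p + q) (+-identityʳ p) (+-monoʳ-< p 0<q)

0<-p+q : ∀ {p q} → p < q → 0ℚ < - p + q
0<-p+q {p} {q} p<q = subst (_< - p + q) (+-inverseˡ p) (+-monoʳ-< (- p) p<q)

singleton∈singletonFamily : {X : Set} (x : X) → singletonFamily x (singleton x)
singleton∈singletonFamily x y = mk⇔ (λ y≡x → y≡x) (λ y≡x → y≡x)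

singletonFamily-point : {X : Set} {x : X} {S : Subset X} → singletonFamily x S → S x
singletonFamily-point {x = x} S∈x* = Equivalence.from (S∈x* x) refl

module Premetric {X : Set} {d : X → X → ℚ → Set} (isPremetric : IsPremetric d) where
  open IsPremetric isPremetric

  dist-mono : ∀ {x y p q} → 0ℚ ≤ p → p ≤ q → d x y p → d x y q
  dist-mono {x} {y} {p} {q} 0≤p p≤q dxy≤p =
    Equivalence.from (limit x y q (≤-trans 0≤p p≤q)) λ r q<r →
      Equivalence.to (limit x y p 0≤p) dxy≤p r (≤-<-trans p≤q q<r)

  dist-refl : ∀ x {q} → 0ℚ ≤ q → d x x q
  dist-refl x 0≤q = dist-mono ≤-refl 0≤q (Equivalence.from (zero-iff x x) refl)

  Diam≤-singleton : ∀ x {q} → 0ℚ ≤ q → Diam≤ d (singleton x) q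
  Diam≤-singleton x 0≤q .x .x refl refl = dist-refl x 0≤q

  Diam≤-singleton-∪ : ∀ {x T δ r} → 0ℚ ≤ δ → δ ≤ r → Diam≤ d T δ →
                      (∀ y → T y → d x y r) → Diam≤ d (_∪_ d (singleton x) T) r
  Diam≤-singleton-∪ {x} 0≤δ δ≤r diamT dx _ _ (inj₁ refl) (inj₁ refl) = dist-refl x (≤-trans 0≤δ δ≤r)
  Diam≤-singleton-∪ 0≤δ δ≤r diamT dx _ z (inj₁ refl) (inj₂ Tz) = dx z Tz
  Diam≤-singleton-∪ {x} 0≤δ δ≤r diamT dx y _ (inj₂ Ty) (inj₁ refl) = sym x y _ (≤-trans 0≤δ δ≤r) (dx y Ty)
  Diam≤-singleton-∪ 0≤δ δ≤r diamT dx y z (inj₂ Ty) (inj₂ Tz) = dist-mono 0≤δ δ≤r (diamT y z Ty Tz)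

  singletonFamily-isCauchy : ∀ x → IsCauchy d (singletonFamily x)
  singletonFamily-isCauchy x = record
    { intersect = λ S T S∈x* T∈x* → x , singletonFamily-point S∈x* , singletonFamily-point T∈x*
    ; small     = λ ε 0<ε → singleton x , singleton∈singletonFamily x , Diam≤-singleton x (<⇒≤ 0<ε)
    }

  dist⇒FamDist≤ : ∀ x x' q → 0ℚ ≤ q → d x x' q →
                  FamDist≤ d (singletonFamily x) (singletonFamily x') q
  dist⇒FamDist≤ x x' q 0≤q dxx'≤q ε 0<ε =
    singleton x , singleton x' ,
    singleton∈singletonFamily x , singleton∈singletonFamily x' ,
    Diam≤-singleton x 0≤ε , Diam≤-singleton x' 0≤ε ,
    Diam≤-singleton-∪ 0≤ε (q≤p+q ε 0≤q) (Diam≤-singleton x' 0≤ε) λ { .x' refl → dxx'≤q+ε }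
    where
    0≤ε : 0ℚ ≤ ε
    0≤ε = <⇒≤ 0<ε
    dxx'≤q+ε : d x x' (q + ε)
    dxx'≤q+ε = dist-mono 0≤q (<⇒≤ (p<p+q q 0<ε)) dxx'≤q

  FamDist≤⇒dist : ∀ x x' q → 0ℚ ≤ q →
                  FamDist≤ d (singletonFamily x) (singletonFamily x') q → d x x' q
  FamDist≤⇒dist x x' q 0≤q d*≤q = Equivalence.from (limit x x' q 0≤q) λ r q<r →
    let (S , T , S∈x* , T∈x'* , _ , _ , diamS∪T) = d*≤q (- q + r) (0<-p+q q<r)
    in subst (d x x') (\\-leftDividesˡ q r)
         (diamS∪T x x' (inj₁ (singletonFamily-point S∈x*)) (inj₂ (singletonFamily-point T∈x'*)))

  FamDist≤-point-of-small-member : ∀ {F S x ε} → IsCauchy d F → F S → Diam≤ d S ε → S x → 0ℚ < ε →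
                                    FamDist≤ d (singletonFamily x) F ε
  FamDist≤-point-of-small-member {S = S} {x} {ε} isCauchy FS diamS Sx 0<ε δ 0<δ
    with IsCauchy.small isCauchy δ 0<δ
  ... | T , FT , diamT =
    singleton x , T , singleton∈singletonFamily x , FT ,
    Diam≤-singleton x (<⇒≤ 0<δ) , diamT ,
    Diam≤-singleton-∪ (<⇒≤ 0<δ) (q≤p+q δ (<⇒≤ 0<ε)) diamT dx≤ε+δ
    where
    dx≤ε+δ : ∀ y → T y → d x y (ε + δ)
    dx≤ε+δ y Ty with IsCauchy.intersect isCauchy S T FS FT
    ... | z , Sz , Tz = triangle x y z ε δ (<⇒≤ 0<ε) (<⇒≤ 0<δ) (diamS x z Sx Sz) (diamT z y Tz Ty)

  singletonFamily-dense : ∀ F → IsCauchy d F → ∀ ε → 0ℚ < ε →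
                          ∃ λ x → FamDist≤ d (singletonFamily x) F ε
  singletonFamily-dense F isCauchy ε 0<ε with IsCauchy.small isCauchy ε 0<ε
  ... | S , FS , diamS with IsCauchy.intersect isCauchy S S FS FS
  ... | x , Sx , _ = x , FamDist≤-point-of-small-member isCauchy FS diamS Sx 0<ε

theorem2p5 : {X : Set} (d : X → X → ℚ → Set) → IsPremetric d →
    ((x : X) → IsCauchy d (singletonFamily x))
    × (∀ (x x' : X) (q : ℚ) → 0ℚ ≤ q →
         (d x x' q ⇔ FamDist≤ d (singletonFamily x) (singletonFamily x') q))
    × (∀ (F : Family X) → IsCauchy d F → ∀ ε → 0ℚ < ε →
         ∃ λ (x : X) → FamDist≤ d (singletonFamily x) F ε)
theorem2p5 d isPremetric =
    singletonFamily-isCauchy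
  , (λ x x' q 0≤q → mk⇔ (dist⇒FamDist≤ x x' q 0≤q) (FamDist≤⇒dist x x' q 0≤q))
  , singletonFamily-dense
  where open Premetric isPremetric
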